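{- For every clause-set $F$ we have $\mathrm{rs}(F) \le 3\,\mathrm{ss}(F) - 2$, where $\mathrm{rs}$ denotes resolution-space complexity and $\mathrm{ss}$ denotes semantic-space complexity (both extended to all clause-sets as described in the context).
   Context: Literals are variables $v$ or negated variables $\overline{v}$; a clause is a finite set of literals without a complementary pair; a clause-set is a finite set of clauses. $\bot$ is the empty clause, $\top$ the empty clause-set; $c(F)$ is the number of clauses of $F$. A partial assignment $\varphi$ is a map from a finite set of variables to $\{0,1\}$; $\varphi * F$ is obtained by removing all clauses containing a literal made true by $\varphi$ and removing all literals made false from the remaining clauses. $F$ is satisfiable if $\varphi*F=\top$ for some $\varphi$, otherwise unsatisfiable. $F \models G$ means every partial assignment $\varphi$ with $\varphi*F=\top$ also satisfies $\varphi*G=\top$. Two clauses $C,D$ are resolvable if $C\cap\overline{D}=\{x\}$ for exactly one literal $x$ (where $\overline{D}$ is the set of complements of literals of $D$); their resolvent is $(C\cup D)\setminus\{x,\overline{x}\}$. Semantic $k$-sequence for $F$ ($k\ge 1$): a sequence $F_1,\dots,F_p$ of clause-sets with $c(F_i)\le k$ for all $i$, $F_1=\top$, and for each $i\ge 2$ either $F_{i-1}\models F_i$ (inference) or $F_i=F_{i-1}\cup\{C\}$ for some $C\in F$ (axiom download). It is complete if $F_p$ is unsatisfiable. For unsatisfiable $F$, $\mathrm{ss}(F)$ is the least $k$ admitting a complete semantic $k$-sequence. Resolution $k$-sequence for $F$: as a semantic $k$-sequence, but each non-download step satisfies $F_i \subseteq F_{i-1}\cup\{R\}$ where either $R$ is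 a resolvent of two clauses of $F_{i-1}$ or no clause is added (removal of clauses and/or addition of one resolvent). It is complete if $\bot\in F_p$; for unsatisfiable $F$, $\mathrm{rs}(F)$ is the least $k$ admitting a complete resolution $k$-sequence. Extension to all clause-sets: for a measure $\mu$ on unsatisfiable clause-sets, set $\mu(\top):=\min\{\mu(G): G \text{ unsatisfiable}\}$, and for $F\ne\top$ set $\mu(F):=\max\{\mu(\varphi*F): \varphi \text{ a partial assignment with } \varphi*F \text{ unsatisfiable}\}$. -}

module Defs where

open import Data.Nat using (ℕ; _≤_; _∸_; _*_)
open import Data.Bool using (Bool; true; false; not; if_then_else_)
open import Data.Maybe using (Maybe; just; nothing)
open import Data.List using (List; []; _∷_; length)
open import Data.List.Membership.Propositional using (_∈_; _∉_)
open import Data.List.Relation.Unary.Any using (Any)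
open import Data.List.Relation.Unary.All using (All)
open import Data.List.Relation.Unary.AllPairs using (AllPairs)
open import Data.Product using (Σ; ∃; _×_; _,_)
open import Data.Sum using (_⊎_)
open import Relation.Nullary using (¬_)
open import Relation.Binary.PropositionalEquality using (_≡_; _≢_)

-- Variables, literals, clauses, clause-sets
-- Finite sets are represented by lists, read as sets (order and
-- repetitions irrelevant); all notions below are invariant under this.

Var : Set
Var = ℕ

data Lit : Set where
  pos : Var → Lit
  neg : Var → Lit

compl : Lit → Lit
compl (pos v) = neg v
compl (neg v) = pos v

Clause : Set
Clause = List Lit

ClauseSet : Set
ClauseSet = List Clause

WFClause : Clause → Set
WFClause C = ∀ x → x ∈ C → compl x ∉ C

WF : ClauseSet → Set
WF F = All WFClause F

_≐_ : Clause → Clause → Set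
C ≐ D = ∀ x → (x ∈ C → x ∈ D) × (x ∈ D → x ∈ C)

_∈ₛ_ : Clause → ClauseSet → Set
C ∈ₛ F = Any (λ D → C ≐ D) F

-- c(F) = n : the number of distinct clauses of F is n
Card : ClauseSet → ℕ → Set
Card F n = Σ ClauseSet λ L →
  length L ≡ n × AllPairs (λ C D → ¬ (C ≐ D)) L
  × (∀ C → C ∈ L → C ∈ₛ F) × (∀ C → C ∈ F → C ∈ₛ L)

CardLe : ClauseSet → ℕ → Set
CardLe F k = ∃ λ n → Card F n × n ≤ k

record PAss : Set where
  field
    val   : Var → Maybe Bool
    bound : ℕ
    fin   : ∀ v → bound ≤ v → val v ≡ nothing
open PAss public

litVal : PAss → Lit → Maybe Bool
litVal φ (pos v) = val φ v
litVal φ (neg v) with val φ v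
... | just b  = just (not b)
... | nothing = nothing

isJust : Bool → Maybe Bool → Bool
isJust true  (just true)  = true
isJust false (just false) = true
isJust _     _            = false

satCl : PAss → Clause → Bool
satCl φ []      = false
satCl φ (x ∷ C) = if isJust true (litVal φ x) then true else satCl φ C

reduceCl : PAss → Clause → Clause
reduceCl φ []      = []
reduceCl φ (x ∷ C) =
  if isJust false (litVal φ x) then reduceCl φ C else x ∷ reduceCl φ C

_*ₐ_ : PAss → ClauseSet → ClauseSet
φ *ₐ []      = []
φ *ₐ (C ∷ F) = if satCl φ C then φ *ₐ F else reduceCl φ C ∷ (φ *ₐ F)

-- ⊤ is the empty clause-set (represented by [])
Satisfiable : ClauseSet → Set
Satisfiable F = ∃ λ (φ : PAss) → φ *ₐ F ≡ []

Unsat : ClauseSet → Set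
Unsat F = ¬ Satisfiable F

_⊨_ : ClauseSet → ClauseSet → Set
F ⊨ G = ∀ (φ : PAss) → φ *ₐ F ≡ [] → φ *ₐ G ≡ []

ResolvableOn : Clause → Clause → Lit → Set
ResolvableOn C D x =
  x ∈ C × compl x ∈ D × (∀ y → y ∈ C → compl y ∈ D → y ≡ x)

IsResolvent : Clause → Clause → Clause → Set
IsResolvent C D R = ∃ λ x → ResolvableOn C D x ×
  (∀ y → (y ∈ R → (y ∈ C ⊎ y ∈ D) × y ≢ x × y ≢ compl x)
       × ((y ∈ C ⊎ y ∈ D) × y ≢ x × y ≢ compl x → y ∈ R))

-- Semantic k-sequences: SemSeq F k G means that there is a semantic
-- k-sequence for F starting at ⊤ and ending in G.

data SemSeq (F : ClauseSet) (k : ℕ) : ClauseSet → Set where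
  start    : SemSeq F k []
  infer    : ∀ {G H} → SemSeq F k G → WF H → G ⊨ H → CardLe H k
           → SemSeq F k H
  download : ∀ {G C} → SemSeq F k G → C ∈ F → CardLe (C ∷ G) k
           → SemSeq F k (C ∷ G)

SemComplete : ClauseSet → ℕ → Set
SemComplete F k = ∃ λ G → SemSeq F k G × Unsat G

ResStep : ClauseSet → ClauseSet → Set
ResStep G H =
  (∀ E → E ∈ H → E ∈ₛ G)
  ⊎ (∃ λ C → ∃ λ D → ∃ λ R → C ∈ G × D ∈ G × IsResolvent C D R
       × (∀ E → E ∈ H → E ∈ₛ G ⊎ E ≐ R))

data ResSeq (F : ClauseSet) (k : ℕ) : ClauseSet → Set where
  start    : ResSeq F k []
  resolve  : ∀ {G H} → ResSeq F k G → ResStep G H → CardLe H k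
           → ResSeq F k H
  download : ∀ {G C} → ResSeq F k G → C ∈ F → CardLe (C ∷ G) k
           → ResSeq F k (C ∷ G)

ResComplete : ClauseSet → ℕ → Set
ResComplete F k = ∃ λ G → ResSeq F k G × [] ∈ G

-- ss and rs on unsatisfiable clause-sets (relationally: IsSS F s means
-- ss(F) = s), as least k ≥ 1 admitting a complete sequence

IsLeastK : (ℕ → Set) → ℕ → Set
IsLeastK P s = 1 ≤ s × P s × (∀ k → 1 ≤ k → P k → s ≤ k)

IsSS : ClauseSet → ℕ → Set
IsSS F s = Unsat F × IsLeastK (SemComplete F) s

IsRS : ClauseSet → ℕ → Set
IsRS F r = Unsat F × IsLeastK (ResComplete F) r

Ext : (ClauseSet → ℕ → Set) → ClauseSet → ℕ → Set
Ext M F m =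
  (F ≡ [] × (∃ λ G → WF G × Unsat G × M G m)
          × (∀ G v → WF G → Unsat G → M G v → m ≤ v))
  ⊎ (F ≢ [] × (∃ λ (φ : PAss) → Unsat (φ *ₐ F) × M (φ *ₐ F) m)
            × (∀ (φ : PAss) v → Unsat (φ *ₐ F) → M (φ *ₐ F) v → v ≤ m))

ss≡ : ClauseSet → ℕ → Set
ss≡ = Ext IsSS

rs≡ : ClauseSet → ℕ → Set
rs≡ = Ext IsRS

-- A semantic k-sequence F₁, …, Fₚ is simulated by resolution configurations M with M ⊨ Fᵢ and
-- |M| ≤ c(Fᵢ). Downloads are copied. An inference Fᵢ₋₁ ⊨ Fᵢ is simulated by deriving from M, one
-- clause E of Fᵢ at a time, a subclause of E; afterwards M is dropped. Such a subclause is found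
-- in the manner of a tree-like refutation: after discarding clauses that clash with E and
-- clauses containing a pure literal, split on a literal x of M outside E, derive subclauses of
-- x̄ ∨ E and x ∨ E from the clauses without x resp. x̄, and resolve them on x. A derivation from S
-- keeps at most |S| − 1 clauses besides the current configuration, so at every moment at most
-- (k − 1) + (k − 1) + k clauses are held. The empty clause is finally derived from the last M.
module Submission where

open import Defs
open import Data.Bool using (Bool; true; false; not; _∨_)
open import Data.Bool.Properties using (not-involutive; ∨-zeroʳ)
open import Data.Empty using (⊥-elim)
open import Data.Maybe using (Maybe; just; nothing)
open import Data.List using ([]; _∷_; length; _++_; filter; concat; map; deduplicate)
open import Data.List.Extrema.Nat using (max; xs≤max)
open import Data.List.Membership.Propositional using (_∈_; _∉_; find; lose)
open import Data.List.Membership.Propositional.Properties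
  using (∈-++⁺ˡ; ∈-++⁺ʳ; ∈-++⁻; ∈-filter⁺; ∈-filter⁻; ∈-map⁺; ∈-concat⁺′)
open import Data.List.Properties using (filter-notAll; length-filter; length-++; ++-assoc)
open import Data.List.Relation.Binary.Subset.Propositional using (_⊆_)
open import Data.List.Relation.Binary.Subset.Propositional.Properties using (⊆[]⇒≡[])
open import Data.List.Relation.Unary.All as All using (All; []; _∷_)
open import Data.List.Relation.Unary.All.Properties using (¬All⇒Any¬)
open import Data.List.Relation.Unary.Unique.DecSetoid.Properties using (deduplicate-!)
open import Data.List.Relation.Unary.AllPairs using ([]; _∷_)
open import Data.List.Relation.Unary.Any as Any using (Any; here; there; any?; _─_)
import Data.List.Relation.Unary.Any.Properties as Any
open import Data.Nat using (ℕ; zero; suc; _≤_; _<_; _∸_; _*_; _+_; z≤n; s≤s; _≤?_; _<?_)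
open import Data.Nat.Induction using (<-rec; <-wellFounded)
open import Data.Nat.Properties
open import Data.Product using (∃; _×_; _,_; proj₁; proj₂)
open import Data.Sum using (_⊎_; inj₁; inj₂; [_,_]′)
open import Function using (_∘_)
open import Induction.WellFounded using (Acc; acc)
open import Relation.Binary using (DecidableEquality; Decidable; IsEquivalence; DecSetoid)
open import Relation.Binary.PropositionalEquality using (_≡_; _≢_; refl; sym; trans; cong; cong₂; subst)
open import Relation.Nullary using (¬_; Dec; yes; no; ¬?; contradiction)
open import Relation.Nullary.Decidable using (map′; _×-dec_; decidable-stable)

_≟ₗ_ : DecidableEquality Lit
pos u ≟ₗ pos v = map′ (cong pos) (λ { refl → refl }) (u ≟ v)
neg u ≟ₗ neg v = map′ (cong neg) (λ { refl → refl }) (u ≟ v)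
pos _ ≟ₗ neg _ = no λ ()
neg _ ≟ₗ pos _ = no λ ()

open import Data.List.Membership.DecPropositional _≟ₗ_ using (_∈?_; _∉?_)
open import Data.List.Relation.Binary.Subset.DecPropositional _≟ₗ_ using (_⊆?_)

compl-involutive : ∀ x → compl (compl x) ≡ x
compl-involutive (pos v) = refl
compl-involutive (neg v) = refl

compl-injective : ∀ {x y} → compl x ≡ compl y → x ≡ y
compl-injective {pos u} {pos .u} refl = refl
compl-injective {neg u} {neg .u} refl = refl

compl-≢ : ∀ x → compl x ≢ x
compl-≢ (pos v) ()
compl-≢ (neg v) ()

WFClause-∷ : ∀ {y C} → compl y ∉ C → WFClause C → WFClause (y ∷ C)
WFClause-∷ {y} ȳ∉C wf .y (here refl) (here ȳ≡y)   = compl-≢ y ȳ≡y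
WFClause-∷ {y} ȳ∉C wf .y (here refl) (there ȳ∈C) = ȳ∉C ȳ∈C
WFClause-∷ {y} {C} ȳ∉C wf z (there z∈C) (here z̄≡y) =
  ȳ∉C (subst (_∈ C) (trans (sym (compl-involutive z)) (cong compl z̄≡y)) z∈C)
WFClause-∷ ȳ∉C wf z (there z∈C) (there z̄∈C) = wf z z∈C z̄∈C

WFClause-≐ : ∀ {C D} → C ≐ D → WFClause D → WFClause C
WFClause-≐ C≐D wf x x∈C x̄∈C = wf x (proj₁ (C≐D x) x∈C) (proj₁ (C≐D (compl x)) x̄∈C)

var : Lit → Var
var (pos v) = v
var (neg v) = v

≐-isEquivalence : IsEquivalence _≐_
≐-isEquivalence = record
  { refl  = λ x → (λ m → m) , (λ m → m)
  ; sym   = λ C≐D x → proj₂ (C≐D x) , proj₁ (C≐D x)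
  ; trans = λ C≐D D≐E x → proj₁ (D≐E x) ∘ proj₁ (C≐D x) , proj₂ (C≐D x) ∘ proj₂ (D≐E x)
  }

⊆×⊇⇒≐ : ∀ {C D} → C ⊆ D × D ⊆ C → C ≐ D
⊆×⊇⇒≐ (C⊆D , D⊆C) x = C⊆D , D⊆C

≐⇒⊆×⊇ : ∀ {C D} → C ≐ D → C ⊆ D × D ⊆ C
≐⇒⊆×⊇ C≐D = proj₁ (C≐D _) , proj₂ (C≐D _)

_≐?_ : Decidable _≐_
C ≐? D = map′ ⊆×⊇⇒≐ ≐⇒⊆×⊇ ((C ⊆? D) ×-dec (D ⊆? C))

≐-decSetoid : DecSetoid _ _
≐-decSetoid = record { isDecEquivalence = record { isEquivalence = ≐-isEquivalence ; _≟_ = _≐?_ } }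

open DecSetoid ≐-decSetoid using () renaming (refl to ≐-refl; sym to ≐-sym; trans to ≐-trans)
open import Data.List.Relation.Unary.Unique.DecSetoid ≐-decSetoid using (Unique)

_⊆ₛ_ : ClauseSet → ClauseSet → Set
G ⊆ₛ H = ∀ C → C ∈ G → C ∈ₛ H

∈⇒∈ₛ : ∀ {C G} → C ∈ G → C ∈ₛ G
∈⇒∈ₛ = Any.map λ { refl → ≐-refl }

⊆⇒⊆ₛ : ∀ {G H} → G ⊆ H → G ⊆ₛ H
⊆⇒⊆ₛ G⊆H C = ∈⇒∈ₛ ∘ G⊆H

∈ₛ-⊆ₛ : ∀ {C G H} → C ∈ₛ G → G ⊆ₛ H → C ∈ₛ H
∈ₛ-⊆ₛ C∈ₛG G⊆ₛH with find C∈ₛG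
... | E , E∈G , C≐E = Any.map (≐-trans C≐E) (G⊆ₛH E E∈G)

length-─ : ∀ {P : Clause → Set} {G} (p : Any P G) → suc (length (G ─ p)) ≡ length G
length-─ (here _)  = refl
length-─ (there p) = cong suc (length-─ p)

∈ₛ-─ : ∀ {C D G} (p : C ∈ₛ G) → D ∈ₛ G → ¬ C ≐ D → D ∈ₛ (G ─ p)
∈ₛ-─ (here C≐E) (here D≐E) C≉D = contradiction (≐-trans C≐E (≐-sym D≐E)) C≉D
∈ₛ-─ (here _)   (there D∈G) _  = D∈G
∈ₛ-─ (there _)  (here D≐E)  _  = here D≐E
∈ₛ-─ (there p)  (there D∈G) C≉D = there (∈ₛ-─ p D∈G C≉D)

unique-⊆ₛ⇒length-≤ : ∀ {L L'} → Unique L → L ⊆ₛ L' → length L ≤ length L'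
unique-⊆ₛ⇒length-≤ {[]} _ _ = z≤n
unique-⊆ₛ⇒length-≤ {C ∷ L} {L'} (C≉L ∷ !L) CL⊆ₛL' = begin
  suc (length L)        ≤⟨ s≤s (unique-⊆ₛ⇒length-≤ !L L⊆ₛL'─C) ⟩
  suc (length (L' ─ p)) ≡⟨ length-─ p ⟩
  length L'             ∎
  where
  open ≤-Reasoning
  p = CL⊆ₛL' C (here refl)
  L⊆ₛL'─C : L ⊆ₛ (L' ─ p)
  L⊆ₛL'─C D D∈L = ∈ₛ-─ p (CL⊆ₛL' D (there D∈L)) (All.lookup C≉L D∈L)

card-mono : ∀ {G H m n} → Card G m → Card H n → G ⊆ₛ H → m ≤ n
card-mono (L , refl , !L , L⊆ₛG , _) (L' , refl , _ , _ , H⊆ₛL') G⊆ₛH =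
  unique-⊆ₛ⇒length-≤ !L λ C C∈L → ∈ₛ-⊆ₛ (∈ₛ-⊆ₛ (L⊆ₛG C C∈L) G⊆ₛH) H⊆ₛL'

cardLe-⊆ₛ : ∀ {H L k} → H ⊆ₛ L → length L ≤ k → CardLe H k
cardLe-⊆ₛ {H} H⊆ₛL |L|≤k =
  length reps , (reps , refl , deduplicate-! ≐-decSetoid H , reps⊆ₛH , H⊆ₛreps) ,
  ≤-trans (unique-⊆ₛ⇒length-≤ (deduplicate-! ≐-decSetoid H) (λ C → H⊆ₛL C ∘ Any.deduplicate⁻ _≐?_)) |L|≤k
  where
  reps = deduplicate _≐?_ H
  reps⊆ₛH : reps ⊆ₛ H
  reps⊆ₛH C = ∈⇒∈ₛ ∘ Any.deduplicate⁻ _≐?_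
  H⊆ₛreps : H ⊆ₛ reps
  H⊆ₛreps C = Any.deduplicate⁺ _≐?_ (λ D'≐D C≐D → ≐-trans C≐D (≐-sym D'≐D)) ∘ ∈⇒∈ₛ

cardLe-length : ∀ {H k} → length H ≤ k → CardLe H k
cardLe-length = cardLe-⊆ₛ (λ C → ∈⇒∈ₛ)

card-∷-∈ₛ : ∀ {C G n} → C ∈ₛ G → Card G n → Card (C ∷ G) n
card-∷-∈ₛ C∈ₛG (L , |L|≡n , !L , L⊆ₛG , G⊆ₛL) = L , |L|≡n , !L , (λ D → there ∘ L⊆ₛG D) , CG⊆ₛL
  where
  CG⊆ₛL : _ ⊆ₛ L
  CG⊆ₛL _ (here refl)  = ∈ₛ-⊆ₛ C∈ₛG G⊆ₛL
  CG⊆ₛL D (there D∈G) = G⊆ₛL D D∈G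

card-∷-∉ₛ : ∀ {C G n} → ¬ C ∈ₛ G → Card G n → Card (C ∷ G) (suc n)
card-∷-∉ₛ {C} C∉ₛG (L , |L|≡n , !L , L⊆ₛG , G⊆ₛL) =
  C ∷ L , cong suc |L|≡n , All.tabulate C≉L ∷ !L , CL⊆ₛCG , CG⊆ₛCL
  where
  C≉L : ∀ {D} → D ∈ L → ¬ C ≐ D
  C≉L D∈L C≐D = C∉ₛG (Any.map (≐-trans C≐D) (L⊆ₛG _ D∈L))
  CL⊆ₛCG : (C ∷ L) ⊆ₛ _
  CL⊆ₛCG _ (here refl)  = here ≐-refl
  CL⊆ₛCG D (there D∈L) = there (L⊆ₛG D D∈L)
  CG⊆ₛCL : _ ⊆ₛ (C ∷ L)
  CG⊆ₛCL _ (here refl)  = here ≐-refl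
  CG⊆ₛCL D (there D∈G) = there (G⊆ₛL D D∈G)

Assignment : Set
Assignment = Var → Bool

evalLit : Assignment → Lit → Bool
evalLit f (pos v) = f v
evalLit f (neg v) = not (f v)

evalClause : Assignment → Clause → Bool
evalClause f []      = false
evalClause f (x ∷ C) = evalLit f x ∨ evalClause f C

Models : Assignment → ClauseSet → Set
Models f S = ∀ {E} → E ∈ S → evalClause f E ≡ true

infix 4 _⊫_ _⊫*_

_⊫_ : ClauseSet → Clause → Set
S ⊫ C = ∀ f → Models f S → evalClause f C ≡ true

_⊫*_ : ClauseSet → ClauseSet → Set
S ⊫* G = ∀ f → Models f S → Models f G

evalLit-compl : ∀ f x → evalLit f (compl x) ≡ not (evalLit f x)
evalLit-compl f (pos v) = refl
evalLit-compl f (neg v) = sym (not-involutive (f v))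

evalClause-∈ : ∀ f {x C} → x ∈ C → evalLit f x ≡ true → evalClause f C ≡ true
evalClause-∈ f (here refl) fx rewrite fx = refl
evalClause-∈ f {C = y ∷ _} (there x∈C) fx = trans (cong (evalLit f y ∨_) (evalClause-∈ f x∈C fx)) (∨-zeroʳ _)

evalClause-⊆ : ∀ f {C D} → C ⊆ D → evalClause f C ≡ true → evalClause f D ≡ true
evalClause-⊆ f {x ∷ C} C⊆D fC with evalLit f x in fx
... | true  = evalClause-∈ f (C⊆D (here refl)) fx
... | false = evalClause-⊆ f (C⊆D ∘ there) fC

evalClause-≐ : ∀ f {C D} → C ≐ D → evalClause f C ≡ true → evalClause f D ≡ true
evalClause-≐ f C≐D = evalClause-⊆ f (proj₁ (C≐D _))

models-∈ₛ : ∀ f {C G} → Models f G → C ∈ₛ G → evalClause f C ≡ true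
models-∈ₛ f ⊨G C∈ₛG with find C∈ₛG
... | E , E∈G , C≐E = evalClause-≐ f (≐-sym C≐E) (⊨G E∈G)

models-filter : ∀ f {P : Clause → Set} (P? : ∀ E → Dec (P E)) {S}
  → (∀ {E} → E ∈ S → ¬ P E → evalClause f E ≡ true)
  → Models f (filter P? S) → Models f S
models-filter f P? outside inside {E} E∈S with P? E
... | yes PE = inside (∈-filter⁺ P? E∈S PE)
... | no ¬PE = outside E∈S ¬PE

falsifier : Clause → Assignment
falsifier C v with neg v ∈? C
... | yes _ = true
... | no _  = false

falsifier-falsifies : ∀ {C} → WFClause C → ∀ D → D ⊆ C → evalClause (falsifier C) D ≡ false
falsifier-falsifies     _  []          _   = refl
falsifier-falsifies {C} wf (pos v ∷ D) D⊆C with neg v ∈? C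
... | yes v̄∈C = contradiction v̄∈C (wf (pos v) (D⊆C (here refl)))
... | no _    = falsifier-falsifies wf D (D⊆C ∘ there)
falsifier-falsifies {C} wf (neg v ∷ D) D⊆C with neg v ∈? C
... | yes _   = falsifier-falsifies wf D (D⊆C ∘ there)
... | no v̄∉C = contradiction (D⊆C (here refl)) v̄∉C

[]⊭ : ∀ {C} → WFClause C → ¬ [] ⊫ C
[]⊭ {C} wf []⊫C with () ← trans (sym ([]⊫C (falsifier C) λ ())) (falsifier-falsifies wf C (λ x∈C → x∈C))

evalClause-false : ∀ f {x C} → evalClause f C ≡ false → x ∈ C → evalLit f x ≡ false
evalClause-false f {x} fC x∈C with evalLit f x in fx
... | false = refl
... | true  = trans (sym (evalClause-∈ f x∈C fx)) fC

evalLit-compl-false : ∀ f x → evalLit f (compl x) ≡ false → evalLit f x ≡ true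
evalLit-compl-false f x fx̄ = trans (sym (not-involutive _)) (cong not (trans (sym (evalLit-compl f x)) fx̄))

polarity : Lit → Bool
polarity (pos _) = true
polarity (neg _) = false

makeTrue : Lit → Assignment → Assignment
makeTrue x f v with v ≟ var x
... | yes _ = polarity x
... | no _  = f v

same-var : ∀ x y → var y ≡ var x → y ≡ x ⊎ y ≡ compl x
same-var (pos v) (pos .v) refl = inj₁ refl
same-var (pos v) (neg .v) refl = inj₂ refl
same-var (neg v) (pos .v) refl = inj₂ refl
same-var (neg v) (neg .v) refl = inj₁ refl

evalLit-makeTrue-self : ∀ f x → evalLit (makeTrue x f) x ≡ true
evalLit-makeTrue-self f (pos v) with v ≟ v
... | yes _   = refl
... | no v≢v = contradiction refl v≢v
evalLit-makeTrue-self f (neg v) with v ≟ v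
... | yes _   = refl
... | no v≢v = contradiction refl v≢v

makeTrue-other : ∀ f x v → v ≢ var x → makeTrue x f v ≡ f v
makeTrue-other f x v v≢x with v ≟ var x
... | yes v≡x = contradiction v≡x v≢x
... | no _    = refl

evalLit-makeTrue-other : ∀ f x y → y ≢ x → y ≢ compl x → evalLit (makeTrue x f) y ≡ evalLit f y
evalLit-makeTrue-other f x y y≢x y≢x̄ = other-var y (λ y≡x → [ y≢x , y≢x̄ ]′ (same-var x y y≡x))
  where
  other-var : ∀ y → var y ≢ var x → evalLit (makeTrue x f) y ≡ evalLit f y
  other-var (pos v) v≢x = makeTrue-other f x v v≢x
  other-var (neg v) v≢x = cong not (makeTrue-other f x v v≢x)

evalClause-makeTrue : ∀ f x C → x ∉ C → compl x ∉ C → evalClause (makeTrue x f) C ≡ evalClause f C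
evalClause-makeTrue f x []      _   _   = refl
evalClause-makeTrue f x (y ∷ C) x∉C x̄∉C = cong₂ _∨_
  (evalLit-makeTrue-other f x y (x∉C ∘ here ∘ sym) (x̄∉C ∘ here ∘ sym))
  (evalClause-makeTrue f x C (x∉C ∘ there) (x̄∉C ∘ there))

Clashes : Clause → Clause → Set
Clashes C D = Any (λ y → compl y ∈ C) D

clashes? : ∀ C D → Dec (Clashes C D)
clashes? C = any? λ y → compl y ∈? C

avoiding : Lit → ClauseSet → ClauseSet
avoiding x = filter (x ∉?_)

avoiding-⊆ : ∀ x S → avoiding x S ⊆ S
avoiding-⊆ x S = proj₁ ∘ ∈-filter⁻ (x ∉?_)

⊫-drop-clashing : ∀ {S C} → S ⊫ C → filter (¬? ∘ clashes? C) S ⊫ C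
⊫-drop-clashing {S} {C} S⊫C f ⊨S' with evalClause f C in fC
... | true  = refl
... | false = trans (sym fC) (S⊫C f (models-filter f (¬? ∘ clashes? C) clashing ⊨S'))
  where
  clashing : ∀ {E} → E ∈ S → ¬ ¬ Clashes C E → evalClause f E ≡ true
  clashing {E} _ ¬¬clash with find (decidable-stable (clashes? C E) ¬¬clash)
  ... | y , y∈E , ȳ∈C = evalClause-∈ f y∈E (evalLit-compl-false f y (evalClause-false f fC ȳ∈C))

⊫-assume : ∀ {S C} x → S ⊫ C → avoiding x S ⊫ compl x ∷ C
⊫-assume {S} x S⊫C f ⊨Sx with evalLit f (compl x) in fx̄
... | true  = refl
... | false = S⊫C f (models-filter f (x ∉?_) containing ⊨Sx)
  where
  containing : ∀ {E} → E ∈ S → ¬ x ∉ E → evalClause f E ≡ true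
  containing {E} _ ¬x∉E =
    evalClause-∈ f (decidable-stable (x ∈? E) ¬x∉E) (evalLit-compl-false f x fx̄)

⊫-pure : ∀ {S C} x → x ∉ C → compl x ∉ C → (∀ {E} → E ∈ S → compl x ∉ E)
  → S ⊫ C → avoiding x S ⊫ C
⊫-pure {S} {C} x x∉C x̄∉C pure S⊫C f ⊨Sx =
  trans (sym (evalClause-makeTrue f x C x∉C x̄∉C)) (S⊫C (makeTrue x f) (models-filter _ (x ∉?_) containing unchanged))
  where
  containing : ∀ {E} → E ∈ S → ¬ x ∉ E → evalClause (makeTrue x f) E ≡ true
  containing {E} _ ¬x∉E = evalClause-∈ _ (decidable-stable (x ∈? E) ¬x∉E) (evalLit-makeTrue-self f x)
  unchanged : Models (makeTrue x f) (avoiding x S)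
  unchanged E∈Sx with ∈-filter⁻ (x ∉?_) E∈Sx
  ... | E∈S , x∉E = trans (evalClause-makeTrue f x _ x∉E (pure E∈S)) (⊨Sx E∈Sx)

∈-⊆∷-≢ : ∀ {D C : Clause} {y z} → D ⊆ y ∷ C → z ∈ D → z ≢ y → z ∈ C
∈-⊆∷-≢ D⊆yC z∈D z≢y with D⊆yC z∈D
... | here z≡y = contradiction z≡y z≢y
... | there z∈C = z∈C

⊆∷-∉ : ∀ {D C : Clause} {y} → D ⊆ y ∷ C → y ∉ D → D ⊆ C
⊆∷-∉ D⊆yC y∉D {z} z∈D = ∈-⊆∷-≢ D⊆yC z∈D λ { refl → y∉D z∈D }

other? : ∀ x y → Dec (y ≢ x × y ≢ compl x)
other? x y = ¬? (y ≟ₗ x) ×-dec ¬? (y ≟ₗ compl x)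

resolventOn : Lit → Clause → Clause → Clause
resolventOn x C D = filter (other? x) (C ++ D)

resolventOn-isResolvent : ∀ {C D x} → ResolvableOn C D x → IsResolvent C D (resolventOn x C D)
resolventOn-isResolvent {C} {D} {x} resolvable = x , resolvable , λ y → out , into
  where
  out : ∀ {y} → y ∈ resolventOn x C D → (y ∈ C ⊎ y ∈ D) × y ≢ x × y ≢ compl x
  out y∈R with ∈-filter⁻ (other? x) {xs = C ++ D} y∈R
  ... | y∈CD , y≢x , y≢x̄ = ∈-++⁻ C y∈CD , y≢x , y≢x̄
  into : ∀ {y} → (y ∈ C ⊎ y ∈ D) × y ≢ x × y ≢ compl x → y ∈ resolventOn x C D
  into (y∈C⊎D , y≢x) = ∈-filter⁺ (other? x) ([ ∈-++⁺ˡ , ∈-++⁺ʳ C ]′ y∈C⊎D) y≢x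

resolvableOn-⊆ : ∀ {C D₁ D₂ x} → WFClause C → D₁ ⊆ x ∷ C → D₂ ⊆ compl x ∷ C
  → x ∈ D₁ → compl x ∈ D₂ → ResolvableOn D₁ D₂ x
resolvableOn-⊆ {C} {D₁} {D₂} {x} wf D₁⊆xC D₂⊆x̄C x∈D₁ x̄∈D₂ = x∈D₁ , x̄∈D₂ , unique
  where
  unique : ∀ y → y ∈ D₁ → compl y ∈ D₂ → y ≡ x
  unique y y∈D₁ ȳ∈D₂ with D₁⊆xC y∈D₁ | D₂⊆x̄C ȳ∈D₂
  ... | here y≡x  | _          = y≡x
  ... | there _   | here ȳ≡x̄  = compl-injective ȳ≡x̄
  ... | there y∈C | there ȳ∈C = contradiction ȳ∈C (wf y y∈C)

resolventOn-⊆ : ∀ {C D₁ D₂ x} → D₁ ⊆ x ∷ C → D₂ ⊆ compl x ∷ C → resolventOn x D₁ D₂ ⊆ C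
resolventOn-⊆ {C} {D₁} {D₂} {x} D₁⊆xC D₂⊆x̄C y∈R
  with y∈D₁D₂ , y≢x , y≢x̄ ← ∈-filter⁻ (other? x) {xs = D₁ ++ D₂} y∈R
  with ∈-++⁻ D₁ y∈D₁D₂
... | inj₁ y∈D₁ = ∈-⊆∷-≢ D₁⊆xC y∈D₁ y≢x
... | inj₂ y∈D₂ = ∈-⊆∷-≢ D₂⊆x̄C y∈D₂ y≢x̄

module Derivation (F : ClauseSet) (K : ℕ) where

  Reachable : ClauseSet → Set
  Reachable = ResSeq F K

  forget : ∀ {G H} → Reachable G → H ⊆ G → CardLe H K → Reachable H
  forget q H⊆G = resolve q (inj₁ (⊆⇒⊆ₛ H⊆G))

  add-resolvent : ∀ {G B C D R} → Reachable G → C ∈ G → D ∈ G → IsResolvent C D R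
    → B ⊆ G → CardLe (R ∷ B) K → Reachable (R ∷ B)
  add-resolvent q C∈G D∈G isResolvent B⊆G = resolve q (inj₂ (_ , _ , _ , C∈G , D∈G , isResolvent , kept))
    where
    kept : ∀ E → E ∈ _ ∷ _ → E ∈ₛ _ ⊎ E ≐ _
    kept E (here refl)  = inj₂ ≐-refl
    kept E (there E∈B) = inj₁ (∈⇒∈ₛ (B⊆G E∈B))

  RoomFor : ClauseSet → ClauseSet → Set
  RoomFor S B = ∀ Y → length Y < length S → CardLe (Y ++ B) K

  -- A subclause of C has been derived from B into at most one extra clause. Derivations from S
  -- only pass through configurations Y ++ B with length Y < length S, so RoomFor S B is all the
  -- space they need.
  data Derived (S : ClauseSet) (C : Clause) (B : ClauseSet) : Set where
    derived : ∀ {D Y} → D ⊆ C → D ∈ Y ++ B → length Y < length S → length Y ≤ 1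
      → Reachable (Y ++ B) → Derived S C B

  DerivesFrom : ClauseSet → Set
  DerivesFrom S = ∀ {C B} → WFClause C → S ⊆ B → S ⊫ C → Reachable B → RoomFor S B → Derived S C B

  RoomFor-mono : ∀ {S S' B} → length S' ≤ length S → RoomFor S B → RoomFor S' B
  RoomFor-mono S'≤S room Y Y<S' = room Y (<-≤-trans Y<S' S'≤S)

  RoomFor-shift : ∀ {S S' B Y₁} → length Y₁ ≤ 1 → length S' < length S → RoomFor S B → RoomFor S' (Y₁ ++ B)
  RoomFor-shift {S} {S'} {B} {Y₁} Y₁≤1 S'<S room Y Y<S' =
    subst (λ G → CardLe G K) (++-assoc Y Y₁ B) (room (Y ++ Y₁) (begin-strict
      length (Y ++ Y₁)      ≡⟨ length-++ Y ⟩
      length Y + length Y₁  ≤⟨ +-monoʳ-≤ (length Y) Y₁≤1 ⟩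
      length Y + 1          ≡⟨ +-comm (length Y) 1 ⟩
      suc (length Y)        ≤⟨ Y<S' ⟩
      length S'             <⟨ S'<S ⟩
      length S              ∎))
    where open ≤-Reasoning

  Derived-mono : ∀ {S S' C B} → length S' ≤ length S → Derived S' C B → Derived S C B
  Derived-mono S'≤S (derived D⊆C D∈ Y<S' Y≤1 q) = derived D⊆C D∈ (<-≤-trans Y<S' S'≤S) Y≤1 q

  derive-filter : ∀ {P : Clause → Set} (P? : ∀ E → Dec (P E)) {S C B}
    → DerivesFrom (filter P? S) → filter P? S ⊫ C
    → WFClause C → S ⊆ B → Reachable B → RoomFor S B → Derived S C B
  derive-filter P? {S} derive' S'⊫C wf S⊆B q room = Derived-mono {S} (length-filter P? S)
    (derive' wf (S⊆B ∘ proj₁ ∘ ∈-filter⁻ P?) S'⊫C q (RoomFor-mono {S} {filter P? S} (length-filter P? S) room))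

  combine-halves : ∀ {S S' C B Y₁ D₁} x → WFClause C → length S' < length S → RoomFor S B
    → D₁ ⊆ compl x ∷ C → compl x ∈ D₁ → D₁ ∈ Y₁ ++ B
    → Derived S' (x ∷ C) (Y₁ ++ B) → Derived S C B
  combine-halves {B = B} {Y₁} {D₁} x wf S'<S room D₁⊆x̄C x̄∈D₁ D₁∈
                 (derived {D₂} {Y₂} D₂⊆xC D₂∈ Y₂<S' _ q₂)
    with x ∈? D₂ | ≤-<-trans (≤-trans (s≤s z≤n) Y₂<S') S'<S
  ... | no x∉D₂ | 1<S = derived (⊆∷-∉ D₂⊆xC x∉D₂) (here refl) 1<S ≤-refl
    (forget q₂ (λ { (here refl) → D₂∈ ; (there E∈B) → ∈-++⁺ʳ Y₂ (∈-++⁺ʳ Y₁ E∈B) }) (room _ 1<S))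
  ... | yes x∈D₂ | 1<S = derived (resolventOn-⊆ D₂⊆xC D₁⊆x̄C) (here refl) 1<S ≤-refl
    (add-resolvent q₂ D₂∈ (∈-++⁺ʳ Y₂ D₁∈)
      (resolventOn-isResolvent (resolvableOn-⊆ wf D₂⊆xC D₁⊆x̄C x∈D₂ x̄∈D₁))
      (∈-++⁺ʳ Y₂ ∘ ∈-++⁺ʳ Y₁) (room _ 1<S))

  derive-split : ∀ {S C B} x → x ∉ C → compl x ∉ C
    → length (avoiding x S) < length S → length (avoiding (compl x) S) < length S
    → DerivesFrom (avoiding x S) → DerivesFrom (avoiding (compl x) S)
    → WFClause C → S ⊆ B → S ⊫ C → Reachable B → RoomFor S B → Derived S C B
  derive-split {S} {C} {B} x x∉C x̄∉C Sₓ<S Sₓ̄<S deriveₓ deriveₓ̄ wf S⊆B S⊫C q room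
    with derived {D₁} {Y₁} D₁⊆x̄C D₁∈ Y₁<Sₓ Y₁≤1 q₁
           ← deriveₓ {compl x ∷ C} (WFClause-∷ (x∉C ∘ subst (_∈ C) (compl-involutive x)) wf)
               (S⊆B ∘ avoiding-⊆ x S) (⊫-assume {S} {C} x S⊫C) q (RoomFor-mono {S} {avoiding x S} (<⇒≤ Sₓ<S) room)
       | compl x ∈? D₁
  ... | no x̄∉D₁ = derived (⊆∷-∉ D₁⊆x̄C x̄∉D₁) D₁∈ (<-trans Y₁<Sₓ Sₓ<S) Y₁≤1 q₁
  ... | yes x̄∈D₁ = combine-halves x wf Sₓ̄<S room D₁⊆x̄C x̄∈D₁ D₁∈
    (deriveₓ̄ {x ∷ C} (WFClause-∷ x̄∉C wf) (∈-++⁺ʳ Y₁ ∘ S⊆B ∘ avoiding-⊆ (compl x) S)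
       (subst (λ y → avoiding (compl x) S ⊫ y ∷ C) (compl-involutive x) (⊫-assume {S} {C} (compl x) S⊫C))
       q₁ (RoomFor-shift {S} {avoiding (compl x) S} Y₁≤1 Sₓ̄<S room))

  derive : ∀ S → Acc _<_ (length S) → DerivesFrom S
  derive [] _ wf _ []⊫C _ _ = contradiction []⊫C ([]⊭ wf)
  derive S@(D ∷ _) (acc smaller) {C} wf S⊆B S⊫C q room with any? (_⊆? C) S
  ... | yes subsumed with E , E∈S , E⊆C ← find subsumed = derived E⊆C (S⊆B E∈S) (s≤s z≤n) z≤n q
  ... | no ¬subsumed with any? (clashes? C) S
  ... | yes clash = derive-filter (¬? ∘ clashes? C)
          (derive _ (smaller (filter-notAll (¬? ∘ clashes? C) S (Any.map (λ c ¬c → ¬c c) clash))))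
          (⊫-drop-clashing {S} S⊫C) wf S⊆B q room
  ... | no ¬clash
    with x , x∈D , x∉C ← find (¬All⇒Any¬ (_∈? C) D (λ D⊆C → ¬subsumed (here (All.lookup D⊆C))))
    with Sₓ<S ← filter-notAll (x ∉?_) S (here λ x∉D → x∉D x∈D)
       | x̄∉C ← (λ x̄∈C → ¬clash (here (lose x∈D x̄∈C)))
       | any? (compl x ∈?_) S
  ... | no pure = derive-filter (x ∉?_) (derive _ (smaller Sₓ<S))
          (⊫-pure {S} x x∉C x̄∉C (λ E∈S x̄∈E → pure (lose E∈S x̄∈E)) S⊫C) wf S⊆B q room
  ... | yes impure = derive-split x x∉C x̄∉C Sₓ<S Sₓ̄<S (derive _ (smaller Sₓ<S)) (derive _ (smaller Sₓ̄<S))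
          wf S⊆B S⊫C q room
    where
    Sₓ̄<S = filter-notAll (compl x ∉?_) S (Any.map (λ x̄∈E x̄∉E → x̄∉E x̄∈E) impure)

restrictTo : ℕ → Assignment → PAss
restrictTo N f = record { val = below ; bound = N ; fin = below-≥ }
  where
  below : Var → Maybe Bool
  below v with v <? N
  ... | yes _ = just (f v)
  ... | no _  = nothing
  below-≥ : ∀ v → N ≤ v → below v ≡ nothing
  below-≥ v N≤v with v <? N
  ... | yes v<N = contradiction N≤v (<⇒≱ v<N)
  ... | no _    = refl

litVal-restrictTo : ∀ {N} f x → var x < N → litVal (restrictTo N f) x ≡ just (evalLit f x)
litVal-restrictTo {N} f (pos v) v<N with v <? N
... | yes _   = refl
... | no v≮N = contradiction v<N v≮N
litVal-restrictTo {N} f (neg v) v<N with v <? N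
... | yes _   = refl
... | no v≮N = contradiction v<N v≮N

VarsBelow : ℕ → ClauseSet → Set
VarsBelow N G = ∀ {x C} → x ∈ C → C ∈ G → var x < N

varBound : ClauseSet → ℕ
varBound G = suc (max 0 (map var (concat G)))

varsBelow-varBound : ∀ G → VarsBelow (varBound G) G
varsBelow-varBound G x∈C C∈G = s≤s (All.lookup (xs≤max 0 _) (∈-map⁺ var (∈-concat⁺′ x∈C C∈G)))

satCl-restrictTo : ∀ {N} f C → (∀ {x} → x ∈ C → var x < N) → satCl (restrictTo N f) C ≡ evalClause f C
satCl-restrictTo f []      _   = refl
satCl-restrictTo f (x ∷ C) C<N rewrite litVal-restrictTo f x (C<N (here refl)) with evalLit f x
... | true  = refl
... | false = satCl-restrictTo f C (C<N ∘ there)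

*ₐ≡[]⇒satCl : ∀ φ G → φ *ₐ G ≡ [] → ∀ {C} → C ∈ G → satCl φ C ≡ true
*ₐ≡[]⇒satCl φ (C ∷ G) φG≡[] C∈G with satCl φ C in φC | C∈G
... | true  | here refl = φC
... | true  | there C∈G = *ₐ≡[]⇒satCl φ G φG≡[] C∈G
*ₐ≡[]⇒satCl φ (C ∷ G) () _ | false | _

satCl⇒*ₐ≡[] : ∀ φ G → (∀ {C} → C ∈ G → satCl φ C ≡ true) → φ *ₐ G ≡ []
satCl⇒*ₐ≡[] φ []      _   = refl
satCl⇒*ₐ≡[] φ (C ∷ G) φG rewrite φG (here refl) = satCl⇒*ₐ≡[] φ G (φG ∘ there)

models⇒*ₐ≡[] : ∀ {N f G} → VarsBelow N G → Models f G → restrictTo N f *ₐ G ≡ []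
models⇒*ₐ≡[] {f = f} {G} G<N ⊨G = satCl⇒*ₐ≡[] _ G λ {C} C∈G →
  trans (satCl-restrictTo f C λ x∈C → G<N x∈C C∈G) (⊨G C∈G)

*ₐ≡[]⇒models : ∀ {N f G} → VarsBelow N G → restrictTo N f *ₐ G ≡ [] → Models f G
*ₐ≡[]⇒models {f = f} {G} G<N φG≡[] {C} C∈G =
  trans (sym (satCl-restrictTo f C λ x∈C → G<N x∈C C∈G)) (*ₐ≡[]⇒satCl _ G φG≡[] C∈G)

unsat⇒¬models : ∀ {G} → Unsat G → ∀ f → ¬ Models f G
unsat⇒¬models {G} unsat f ⊨G = unsat (_ , models⇒*ₐ≡[] (varsBelow-varBound G) ⊨G)

⊨⇒⊫* : ∀ {G H} → G ⊨ H → G ⊫* H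
⊨⇒⊫* {G} {H} G⊨H f ⊨G = *ₐ≡[]⇒models H<N (G⊨H _ (models⇒*ₐ≡[] G<N ⊨G))
  where
  G<N : VarsBelow (varBound (G ++ H)) G
  G<N x∈C = varsBelow-varBound (G ++ H) x∈C ∘ ∈-++⁺ˡ
  H<N : VarsBelow (varBound (G ++ H)) H
  H<N x∈C = varsBelow-varBound (G ++ H) x∈C ∘ ∈-++⁺ʳ G

space-bound : ∀ {a b m k} → a < m → b < k → m ≤ k → a + (b + m) ≤ 3 * k ∸ 2
space-bound {a} {b} {m} {k} a<m b<k m≤k = m+n≤o⇒m≤o∸n (a + (b + m)) (begin
  a + (b + m) + 2          ≡⟨ +-comm (a + (b + m)) 2 ⟩
  suc (suc (a + (b + m)))  ≡⟨ cong suc (+-suc a (b + m)) ⟨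
  suc a + (suc b + m)      ≤⟨ +-mono-≤ (≤-trans a<m m≤k) (+-mono-≤ b<k m≤k) ⟩
  k + (k + k)              ≡⟨ cong (λ n → k + (k + n)) (+-identityʳ k) ⟨
  3 * k                    ∎)
  where open ≤-Reasoning

k≤3k∸2 : ∀ k → k ≤ 3 * k ∸ 2
k≤3k∸2 zero    = z≤n
k≤3k∸2 (suc k) = space-bound {0} {0} (s≤s z≤n) (s≤s z≤n) ≤-refl

Subsumes : ClauseSet → ClauseSet → Set
Subsumes Ds T = ∀ {E} → E ∈ T → ∃ λ D → D ∈ Ds × D ⊆ E

subsumes⇒⊫* : ∀ {Ds T} → Subsumes Ds T → Ds ⊫* T
subsumes⇒⊫* subsumes f ⊨Ds E∈T with D , D∈Ds , D⊆E ← subsumes E∈T = evalClause-⊆ f D⊆E (⊨Ds D∈Ds)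

module Simulation (F : ClauseSet) (k : ℕ) where

  open Derivation F (3 * k ∸ 2)

  -- Scratch clauses of one derivation, clauses already derived for the next configuration, and
  -- the current configuration: (k ∸ 1) + (k ∸ 1) + k clauses.
  length-++-bound : ∀ {Y A M : ClauseSet} → length Y < length M → length A < k → length M ≤ k
    → length (Y ++ A ++ M) ≤ 3 * k ∸ 2
  length-++-bound {Y} {A} {M} Y<M A<k M≤k = begin
    length (Y ++ A ++ M)              ≡⟨ length-++ Y ⟩
    length Y + length (A ++ M)        ≡⟨ cong (length Y +_) (length-++ A) ⟩
    length Y + (length A + length M)  ≤⟨ space-bound Y<M A<k M≤k ⟩
    3 * k ∸ 2                         ∎
    where open ≤-Reasoning


  derive-next : ∀ {E M Ds} → WFClause E → M ⊫ E → length Ds < k → length M ≤ k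
    → Reachable (Ds ++ M) → ∃ λ D → D ⊆ E × Reachable (D ∷ Ds ++ M)
  derive-next {E} {M} {Ds} wfE M⊫E Ds<k M≤k q =
    keep (derive M (<-wellFounded _) wfE (∈-++⁺ʳ Ds) M⊫E q
           (λ Y Y<M → cardLe-length (length-++-bound {Y} {Ds} {M} Y<M Ds<k M≤k)))
    where
    keep : Derived M E (Ds ++ M) → ∃ λ D → D ⊆ E × Reachable (D ∷ Ds ++ M)
    keep (derived {D} {Y} D⊆E D∈ Y<M _ q′) =
      D , D⊆E , forget q′ D∷B⊆ (cardLe-⊆ₛ (⊆⇒⊆ₛ D∷B⊆) (length-++-bound {Y} {Ds} {M} Y<M Ds<k M≤k))
      where
      D∷B⊆ : D ∷ Ds ++ M ⊆ Y ++ Ds ++ M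
      D∷B⊆ (here refl) = D∈
      D∷B⊆ (there C∈)  = ∈-++⁺ʳ Y C∈

  deriveAll : ∀ T {M} → length T ≤ k → length M ≤ k → All WFClause T → (∀ {E} → E ∈ T → M ⊫ E)
    → Reachable M → ∃ λ Ds → length Ds ≡ length T × Subsumes Ds T × Reachable (Ds ++ M)
  deriveAll [] _ _ _ _ q = [] , refl , (λ ()) , q
  deriveAll (E ∷ T) ET≤k M≤k (wfE ∷ wfT) M⊫ET q
    with Ds , Ds≡T , subsumes , q₁ ← deriveAll T (≤-trans (n≤1+n _) ET≤k) M≤k wfT (M⊫ET ∘ there) q
    with D , D⊆E , q₂ ← derive-next wfE (M⊫ET (here refl)) (≤-trans (s≤s (≤-reflexive Ds≡T)) ET≤k) M≤k q₁
    = D ∷ Ds , cong suc Ds≡T , subsumes′ , q₂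
    where
    subsumes′ : Subsumes (D ∷ Ds) (E ∷ T)
    subsumes′ (here refl)  = D , here refl , D⊆E
    subsumes′ (there E∈T) with D′ , D′∈Ds , D′⊆E ← subsumes E∈T = D′ , there D′∈Ds , D′⊆E

  record Simulates (G M : ClauseSet) : Set where
    field
      {size}      : ℕ
      card        : Card G size
      size≤k      : size ≤ k
      length≤size : length M ≤ size
      entails     : M ⊫* G
      reached     : Reachable M

  open Simulates

  simulate-download : ∀ {G M C} → Simulates G M → C ∈ F → CardLe (C ∷ G) k → ∃ (Simulates (C ∷ G))
  simulate-download {G} {M} {C} sim C∈F (_ , card′ , size′≤k) with any? (C ≐?_) G
  ... | yes C∈ₛG = M , record
    { card        = card-∷-∈ₛ C∈ₛG (card sim)
    ; size≤k      = size≤k sim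
    ; length≤size = length≤size sim
    ; entails     = λ f ⊨M → λ { (here refl) → models-∈ₛ f (entails sim f ⊨M) C∈ₛG ; (there E∈G) → entails sim f ⊨M E∈G }
    ; reached     = reached sim
    }
  ... | no C∉ₛG = C ∷ M , record
    { card        = card-∷-∉ₛ C∉ₛG (card sim)
    ; size≤k      = size+1≤k
    ; length≤size = s≤s (length≤size sim)
    ; entails     = λ f ⊨CM → λ { (here refl) → ⊨CM (here refl) ; (there E∈G) → entails sim f (⊨CM ∘ there) E∈G }
    ; reached     = download (reached sim) C∈F
                      (cardLe-length (≤-trans (s≤s (length≤size sim)) (≤-trans size+1≤k (k≤3k∸2 k))))
    }
    where
    size+1≤k = ≤-trans (card-mono (card-∷-∉ₛ C∉ₛG (card sim)) card′ (λ _ → ∈⇒∈ₛ)) size′≤k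

  simulate-infer : ∀ {G H M} → Simulates G M → WF H → G ⊨ H → CardLe H k → ∃ (Simulates H)
  simulate-infer {G} {H} {M} sim wfH G⊨H (_ , card′@(L , refl , _ , L⊆ₛH , H⊆ₛL) , L≤k) =
    conclude (deriveAll L L≤k (≤-trans (length≤size sim) (size≤k sim)) wfL M⊫L (reached sim))
    where
    wfL : All WFClause L
    wfL = All.tabulate λ {E} E∈L → let E′ , E′∈H , E≐E′ = find (L⊆ₛH E E∈L) in WFClause-≐ E≐E′ (All.lookup wfH E′∈H)
    M⊫L : ∀ {E} → E ∈ L → M ⊫ E
    M⊫L {E} E∈L f ⊨M = models-∈ₛ f (⊨⇒⊫* G⊨H f (entails sim f ⊨M)) (L⊆ₛH E E∈L)
    conclude : (∃ λ Ds → length Ds ≡ length L × Subsumes Ds L × Reachable (Ds ++ M)) → ∃ (Simulates H)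
    conclude (Ds , Ds≡L , subsumes , q) = Ds , record
      { card        = card′
      ; size≤k      = L≤k
      ; length≤size = ≤-reflexive Ds≡L
      ; entails     = λ f ⊨Ds {E} E∈H → models-∈ₛ f (subsumes⇒⊫* subsumes f ⊨Ds) (H⊆ₛL E E∈H)
      ; reached     = forget q ∈-++⁺ˡ (cardLe-length (≤-trans (≤-reflexive Ds≡L) (≤-trans L≤k (k≤3k∸2 k))))
      }

  simulate : ∀ {G} → SemSeq F k G → ∃ (Simulates G)
  simulate start = [] , record
    { card = [] , refl , [] , (λ _ ()) , (λ _ ()) ; size≤k = z≤n ; length≤size = z≤n
    ; entails = λ _ _ () ; reached = start }
  simulate (infer s wfH G⊨H H≤k)   = simulate-infer (proj₂ (simulate s)) wfH G⊨H H≤k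
  simulate (download s C∈F CG≤k) = simulate-download (proj₂ (simulate s)) C∈F CG≤k

  complete : 1 ≤ k → SemComplete F k → ResComplete F (3 * k ∸ 2)
  complete 1≤k (G , s , unsat) = refute (proj₂ (simulate s))
    where
    refute : ∀ {M} → Simulates G M → ResComplete F (3 * k ∸ 2)
    refute {M} sim = conclude (deriveAll ([] ∷ []) 1≤k (≤-trans (length≤size sim) (size≤k sim)) ((λ _ ()) ∷ []) M⊫⊥ (reached sim))
      where
      M⊫⊥ : ∀ {E} → E ∈ [] ∷ [] → M ⊫ E
      M⊫⊥ (here refl) f ⊨M = ⊥-elim (unsat⇒¬models unsat f (entails sim f ⊨M))
      conclude : (∃ λ Ds → length Ds ≡ 1 × Subsumes Ds ([] ∷ []) × Reachable (Ds ++ M)) → ResComplete F (3 * k ∸ 2)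
      conclude (Ds , _ , subsumes , q) with D , D∈Ds , D⊆[] ← subsumes (here refl) =
        Ds ++ M , q , ∈-++⁺ˡ (subst (_∈ Ds) (⊆[]⇒≡[] D⊆[]) D∈Ds)

¬¬-least : ∀ {P : ℕ → Set} {k} → 1 ≤ k → P k → ¬ ¬ ∃ (IsLeastK P)
¬¬-least {P} 1≤k Pk no-least = <-rec (λ m → 1 ≤ m → ¬ P m) below-least _ 1≤k Pk
  where
  below-least : ∀ m → (∀ {j} → j < m → 1 ≤ j → ¬ P j) → 1 ≤ m → ¬ P m
  below-least m none-below 1≤m Pm =
    no-least (m , 1≤m , Pm , λ j 1≤j Pj → ≮⇒≥ λ j<m → none-below j<m 1≤j Pj)

semSeq-download-all : ∀ {F k} T → T ⊆ F → length T ≤ k → SemSeq F k T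
semSeq-download-all []      _    _    = start
semSeq-download-all (C ∷ T) CT⊆F CT≤k =
  download (semSeq-download-all T (CT⊆F ∘ there) (≤-trans (n≤1+n _) CT≤k)) (CT⊆F (here refl)) (cardLe-length CT≤k)

unsat⇒nonempty : ∀ {G} → Unsat G → 1 ≤ length G
unsat⇒nonempty {[]}    unsat = contradiction (restrictTo 0 (λ _ → true) , refl) unsat
unsat⇒nonempty {_ ∷ _} _     = s≤s z≤n

¬¬-ss : ∀ {G} → Unsat G → ¬ ¬ ∃ (IsSS G)
¬¬-ss {G} unsat no-ss =
  ¬¬-least {SemComplete G} (unsat⇒nonempty {G} unsat) (G , semSeq-download-all G (λ C∈G → C∈G) ≤-refl , unsat)
    λ (s , least) → no-ss (s , unsat , least)

rs≤3ss∸2 : ∀ {G r s} → IsRS G r → IsSS G s → r ≤ 3 * s ∸ 2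
rs≤3ss∸2 {G} {s = s} (_ , _ , _ , r-least) (_ , 1≤s , complete , _) =
  r-least (3 * s ∸ 2) (≤-trans 1≤s (k≤3k∸2 s)) (Simulation.complete G s 1≤s complete)

unsat-⊥ : Unsat ([] ∷ [])
unsat-⊥ (_ , ())

rs-⊥ : IsRS ([] ∷ []) 1
rs-⊥ = unsat-⊥ , ≤-refl , ([] ∷ [] , download start (here refl) (cardLe-length ≤-refl) , here refl) , λ _ 1≤k _ → 1≤k

-- ss and rs are least elements, which exist only under double negation; that suffices since the
-- goal is decidable.
theorem3p11 : (F : ClauseSet) → WF F → (s r : ℕ) →
    ss≡ F s → rs≡ F r → r ≤ 3 * s ∸ 2
theorem3p11 F _ s r (inj₁ (_ , (_ , _ , _ , _ , 1≤s , _) , _)) (inj₁ (_ , _ , rs⊤-least)) =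
  -- rs(⊤) ≤ rs({⊥}) = 1 ≤ ss(⊤)
  ≤-trans (rs⊤-least ([] ∷ []) 1 ((λ _ ()) ∷ []) unsat-⊥ rs-⊥) (≤-trans 1≤s (k≤3k∸2 s))
theorem3p11 F _ s r (inj₁ (F≡⊤ , _)) (inj₂ (F≢⊤ , _)) = contradiction F≡⊤ F≢⊤
theorem3p11 F _ s r (inj₂ (F≢⊤ , _)) (inj₁ (F≡⊤ , _)) = contradiction F≡⊤ F≢⊤
theorem3p11 F _ s r (inj₂ (_ , _ , ss-max)) (inj₂ (_ , (φ , unsat , rs-φF) , _)) =
  decidable-stable (r ≤? 3 * s ∸ 2) λ r≰ → ¬¬-ss unsat λ (v , ss-φF) →
    r≰ (≤-trans (rs≤3ss∸2 rs-φF ss-φF) (∸-monoˡ-≤ 2 (*-monoʳ-≤ 3 (ss-max φ v unsat ss-φF))))
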